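{- Let $\mathcal{A}=(Q,\delta,I,Q_F\cup\delta_F)$ be a Büchi automaton and $\mu_0\colon2^Q\to\omega$ a tight rank upper bound (TRUB). Consider any sequence $\mu_0,\mu_1,\mu_2,\dots$ where each $\mu_{j+1}$ is obtained from $\mu_j$ by choosing some $S_j\subseteq Q$ and setting $\mu_{j+1}(S_j)=\mathrm{upd}_{out}(\mu_j,S_j,R_1,\dots,R_m)$ (with $R_1,\dots,R_m$ the sets $R$ with $\delta(R,a)=S_j$ for some $a\in\Sigma$) and $\mu_{j+1}(P)=\mu_j(P)$ for $P\ne S_j$. Then every $\mu_j$ is a TRUB, and $\mu_{j+1}\ne\mu_j$ holds for only finitely many $j$; in particular the outer macrostate analysis (iterating these updates until a fixpoint $\mu^*_{out}$ with $\mu^*_{out}(S)=\mathrm{upd}_{out}(\mu^*_{out},S,\dots)$ for all $S$) terminates and returns a TRUB.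
   Context: BAs: $\mathcal{A}=(Q,\delta,I,Q_F\cup\delta_F)$ over finite $\Sigma$, with $\delta\colon Q\times\Sigma\to2^Q$, initial states $I$, accepting states $Q_F$ and accepting transitions $\delta_F\subseteq\delta$; runs are accepting iff a state of $Q_F$ or a transition of $\delta_F$ occurs infinitely often; $\mathcal{L}(\mathcal{A})$ is the set of accepted words; $\delta(R,a)=\bigcup_{r\in R}\delta(r,a)$; $n=|Q|$; $x\mathbin{\dot- }y=\max\{x-y,0\}$. $\mathrm{upd}_{out}(\mu,S,R_1,\dots,R_m)=\min\{\mu(S),\max\{\mu(R_1),\dots,\mu(R_m)\}\}$ with $\max\emptyset=0$. Run DAG: $\mathcal{G}_\alpha$ has vertices $(q,i)$ such that some run from an initial state over $\alpha$ has $\rho_i=q$, edges $((q,i),(q',i+1))$ for $q'\in\delta(q,\alpha_i)$; vertex $(p,i)$ accepting if $p\in Q_F$, edge accepting if it corresponds to a transition of $\delta_F$; finite vertex: finitely many vertices reachable; endangered: no accepting vertex or edge reachable. With $\mathcal{G}^0=\mathcal{G}_\alpha$, $j=0$, repeat until fixpoint or at most $2n+1$ times: rank $j$ to finite vertices of $\mathcal{G}^j$, remove them; rank $j+1$ to endangered vertices of the result, remove them; $j\gets j+2$; others rank $\omega$. $\mathrm{level}_\alpha(\ell)=\{q\mid(q,\ell)\in\mathcal{G}_\alpha\}$; $f^\alpha_\ell(q)$ = rank of $(q,\ell)$ if $q\in\mathrm{level}_\alpha(\ell)$, else $0$. For $f\colon Q\to\omega$, $\mathrm{rank}(f)=\max_qf(q)$;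 $f$ is tight if $r=\mathrm{rank}(f)$ is odd and $f(Q)\supseteq\{1,3,\dots,r\}$. Level $\ell$ is tight if for all $k\ge\ell$, $f^\alpha_k$ is tight with $\mathrm{rank}(f^\alpha_k)=\mathrm{rank}(f^\alpha_\ell)$. A map $\nu$ from $2^Q$ to functions $Q\to\omega$ is a TRUB iff for every $\alpha\notin\mathcal{L}(\mathcal{A})$ there is a tight level $\ell$ with $\nu(\mathrm{level}_\alpha(k))\ge f^\alpha_k$ pointwise for all $k\ge\ell$. A map $\mu\colon2^Q\to\omega$ is a TRUB iff $\inf(\mu)$ is, where $\inf(\mu)(S)(q)=\mu(S)\mathbin{\dot- }1$ if $q\in Q_F$ and $\mu(S)$ otherwise. -}

module Defs where

open import Data.Nat using (ℕ; zero; suc; _+_; _*_; _∸_; _≤_; _<_; _⊔_; _⊓_)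
open import Data.Bool using (Bool; true; false; if_then_else_)
import Data.Bool as Bool
open import Data.Fin using (Fin)
open import Data.Fin.Subset using (Subset; _∈_; _⊆_; ⋃; inside; outside)
open import Data.Fin.Subset.Properties using (_∈?_)
open import Data.Fin.Properties using (any?)
open import Data.Vec using (Vec; []; _∷_; tabulate)
open import Data.Vec.Properties using (≡-dec)
open import Data.List using (List; []; _∷_; map; filter; foldr; _++_)
import Data.List.Membership.Propositional as LMem
open import Data.Product using (Σ; ∃; ∃-syntax; _×_; _,_)
open import Data.Sum using (_⊎_)
open import Relation.Nullary using (¬_; Dec; does)
open import Relation.Nullary.Decidable using (_×-dec_)
open import Relation.Binary.PropositionalEquality using (_≡_)
open import Function.Bundles using (_⇔_)

record BA (n k : ℕ) : Set where
  field
    δ     : Fin n → Fin k → Subset n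
    I     : Subset n
    QF    : Subset n
    δF    : Fin n → Fin k → Subset n
    δF⊆δ  : ∀ q a → δF q a ⊆ δ q a

open BA public

-- δ(R,a) = ⋃_{r ∈ R} δ(r,a)
post : ∀ {n k} → BA n k → Subset n → Fin k → Subset n
post A R a = tabulate λ q′ → does (any? λ r → (r ∈? R) ×-dec (q′ ∈? δ A r a))

Word : ℕ → Set
Word k = ℕ → Fin k

IsRun : ∀ {n k} → BA n k → Word k → (ℕ → Fin n) → Set
IsRun A α ρ = (ρ 0 ∈ I A) × (∀ i → ρ (suc i) ∈ δ A (ρ i) (α i))

AcceptingRun : ∀ {n k} → BA n k → Word k → (ℕ → Fin n) → Set
AcceptingRun A α ρ =
  ∀ N → ∃[ i ] (N ≤ i × (ρ i ∈ QF A ⊎ ρ (suc i) ∈ δF A (ρ i) (α i)))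

Accepts : ∀ {n k} → BA n k → Word k → Set
Accepts A α = ∃[ ρ ] (IsRun A α ρ × AcceptingRun A α ρ)

Vertex : ℕ → Set
Vertex n = Fin n × ℕ

Odd : ℕ → Set
Odd r = ∃[ m ] r ≡ suc (2 * m)

module RunDAG {n k : ℕ} (A : BA n k) (α : Word k) where

  -- (q , i) is a vertex of G_α: some run (prefix) from an initial state
  -- over α is in q at position i.
  data InDAG : ℕ → Fin n → Set where
    init : ∀ {q} → q ∈ I A → InDAG 0 q
    next : ∀ {i q q′} → InDAG i q → q′ ∈ δ A q (α i) → InDAG (suc i) q′

  Edge : Vertex n → Vertex n → Set
  Edge (q , i) (q′ , i′) = (i′ ≡ suc i) × (q′ ∈ δ A q (α i))

  AccVertex : Vertex n → Set
  AccVertex (p , i) = p ∈ QF A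

  AccEdge : Vertex n → Vertex n → Set
  AccEdge (q , i) (q′ , i′) = q′ ∈ δF A q (α i)

  data Reach (P : Vertex n → Set) : Vertex n → Vertex n → Set where
    here : ∀ {v} → P v → Reach P v v
    step : ∀ {v w u} → P v → Edge v w → Reach P w u → Reach P v u

  IsFinite : (Vertex n → Set) → Vertex n → Set
  IsFinite P v = ∃[ L ] (∀ w → Reach P v w → w LMem.∈ L)

  Endangered : (Vertex n → Set) → Vertex n → Set
  Endangered P v =
    ∀ w → Reach P v w →
      ¬ AccVertex w × (∀ w′ → P w′ → Edge w w′ → ¬ AccEdge w w′)

  -- G^{2j} (Gev j) and G^{2j+1} (Godd j)
  mutual
    Gev : ℕ → Vertex n → Set
    Gev zero    (q , i) = InDAG i q
    Gev (suc j) v       = Godd j v × ¬ Endangered (Godd j) v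

    Godd : ℕ → Vertex n → Set
    Godd j v = Gev j v × ¬ IsFinite (Gev j) v

  -- vertex v receives the (finite) rank r; the loop runs at most 2n+1
  -- times (iterations j = 0, …, 2n); vertices never ranked have rank ω.
  data HasRank (v : Vertex n) : ℕ → Set where
    finite     : ∀ {j} → j < suc (2 * n) → Gev j v → IsFinite (Gev j) v →
                 HasRank v (2 * j)
    endangered : ∀ {j} → j < suc (2 * n) → Godd j v → Endangered (Godd j) v →
                 HasRank v (suc (2 * j))

  InLevel : ℕ → Fin n → Set
  InLevel ℓ q = InDAG ℓ q

  -- f^α_ℓ(q) = r  (as a relation; f^α_ℓ(q) = ω means no r)
  F : ℕ → Fin n → ℕ → Set
  F ℓ q r = (¬ InLevel ℓ q × r ≡ 0) ⊎ (InLevel ℓ q × HasRank (q , ℓ) r)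

  TightWithRank : ℕ → ℕ → Set
  TightWithRank k r =
    Odd r
    × (∀ q → ∃[ s ] (F k q s × s ≤ r))
    × (∃[ q ] F k q r)
    × (∀ o → Odd o → o ≤ r → ∃[ q ] F k q o)

  TightLevel : ℕ → Set
  TightLevel ℓ = ∃[ r ] (∀ m → ℓ ≤ m → TightWithRank m r)

TRUBν : ∀ {n k} → BA n k → (Subset n → Fin n → ℕ) → Set
TRUBν {n} {k} A ν =
  ∀ (α : Word k) → ¬ Accepts A α →
    ∃[ ℓ ] (RunDAG.TightLevel A α ℓ ×
      (∀ m → ℓ ≤ m → ∀ (S : Subset n) →
         (∀ q → (q ∈ S) ⇔ RunDAG.InLevel A α m q) →
         ∀ q r → RunDAG.F A α m q r → r ≤ ν S q))

infFun : ∀ {n k} → BA n k → (Subset n → ℕ) → Subset n → Fin n → ℕ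
infFun A μ S q = if does (q ∈? QF A) then μ S ∸ 1 else μ S

TRUB : ∀ {n k} → BA n k → (Subset n → ℕ) → Set
TRUB A μ = TRUBν A (infFun A μ)

allSubsets : ∀ n → List (Subset n)
allSubsets zero    = [] ∷ []
allSubsets (suc n) = map (inside ∷_) (allSubsets n) ++ map (outside ∷_) (allSubsets n)

_≟S_ : ∀ {n} (S T : Subset n) → Dec (S ≡ T)
_≟S_ = ≡-dec Bool._≟_

maxList : List ℕ → ℕ
maxList = foldr _⊔_ 0      -- max ∅ = 0

predecessors : ∀ {n k} → BA n k → Subset n → List (Subset n)
predecessors {n} A S = filter (λ R → any? (λ a → post A R a ≟S S)) (allSubsets n)

updOut : ∀ {n k} → BA n k → (Subset n → ℕ) → Subset n → ℕ
updOut A μ S = μ S ⊓ maxList (map μ (predecessors A S))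

OuterStep : ∀ {n k} → BA n k → (Subset n → ℕ) → Subset n → (Subset n → ℕ) → Set
OuterStep {n} A μ S μ′ =
  (μ′ S ≡ updOut A μ S) × (∀ (P : Subset n) → ¬ P ≡ S → μ′ P ≡ μ P)

-- An update lowers μ only at S, and there to at most max μ(R) over the R with
-- δ(R,a) = S for some a.  Fix a rejected word α with tight level ℓ and tight
-- rank r.  For m ≥ ℓ we have level(m+1) = δ(level m, α_m), so level m is one of
-- these R; and r, being odd, is attained at a non-accepting state of level m,
-- whence r ≤ μ(level m) ≤ max μ(R).  All ranks on level m+1 are ≤ r, and < r on
-- accepting states (those never carry odd ranks), so the updated μ still
-- dominates the ranks from level ℓ+1 on.  Termination: the μ_j are pointwise
-- non-increasing on the finite set 2^Q, so they are eventually constant; this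
-- is only available constructively under a double negation.
module Submission where

open import Defs
open import Data.Nat using (ℕ; suc; _≤_)
open import Data.Fin.Subset using (Subset)
open import Data.Product using (∃-syntax; _×_)
open import Relation.Nullary using (¬_)
open import Relation.Binary.PropositionalEquality using (_≡_)

open import Level using (0ℓ)
open import Data.Nat using (zero; _∸_; _<_; _≤′_; ≤′-refl; ≤′-step; _⊔_; _⊓_; s≤s)
open import Data.Nat.Properties
open import Data.Bool using (true; false; if_then_else_)
open import Data.Fin using (Fin)
open import Data.Fin.Subset using (_∈_; inside; outside)
open import Data.Fin.Subset.Properties using (_∈?_; ⊆-antisym)
open import Data.Fin.Properties using (any?)
open import Data.Vec using ([]; _∷_; here)
open import Data.Vec.Properties using (lookup∘tabulate; []=⇒lookup; lookup⇒[]=)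
open import Data.List using (map)
import Data.List.Membership.Propositional as List
open import Data.List.Membership.Propositional.Properties using (∈-map⁺; ∈-++⁺ˡ; ∈-++⁺ʳ; ∈-filter⁺)
open import Data.List.Relation.Unary.Any using (Any)
open import Data.Product using (_,_; proj₁; proj₂)
open import Data.Sum using (inj₁; inj₂)
open import Data.Empty using (⊥; ⊥-elim)
open import Data.Bool.Properties using (T-≡)
open import Effect.Monad using (RawMonad)
open import Relation.Nullary using (Dec; yes; no; does)
open import Relation.Nullary.Decidable using (_×-dec_; dec-true; isYes≗does; toWitness)
open import Relation.Nullary.Negation using (¬¬-Monad)
open import Relation.Binary using (tri<; tri≈; tri>)
open import Relation.Binary.PropositionalEquality using (refl; sym; trans; subst)
open import Function.Bundles using (_⇔_; mk⇔; Equivalence)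

open RawMonad (¬¬-Monad {a = 0ℓ})

∈⇒≤maxList : ∀ {x xs} → x List.∈ xs → x ≤ maxList xs
∈⇒≤maxList (Any.here refl)  = m≤m⊔n _ _
∈⇒≤maxList (Any.there x∈xs) = m≤n⇒m≤o⊔n _ (∈⇒≤maxList x∈xs)

∈-allSubsets : ∀ n (R : Subset n) → R List.∈ allSubsets n
∈-allSubsets zero    []          = Any.here refl
∈-allSubsets (suc n) (true ∷ R)  = ∈-++⁺ˡ (∈-map⁺ (inside ∷_) (∈-allSubsets n R))
∈-allSubsets (suc n) (false ∷ R) =
  ∈-++⁺ʳ (map (inside ∷_) (allSubsets n)) (∈-map⁺ (outside ∷_) (∈-allSubsets n R))

antitone : (s : ℕ → ℕ) → (∀ j → s (suc j) ≤ s j) → ∀ {j j′} → j ≤′ j′ → s j′ ≤ s j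
antitone s s↓ ≤′-refl        = ≤-refl
antitone s s↓ (≤′-step j≤j′) = ≤-trans (s↓ _) (antitone s s↓ j≤j′)

¬¬-stabilises : (s : ℕ → ℕ) → (∀ j → s (suc j) ≤ s j) →
                ¬ ¬ (∃[ N ] (∀ j → N ≤ j → s (suc j) ≡ s j))
¬¬-stabilises s s↓ unstable = no-value-below (suc (s 0)) 0 ≤-refl
  where
  -- Descent on the strict bound v for s j: were the tail from j not constant,
  -- a strict drop inside it would give a later index with bound v - 1.
  no-value-below : ∀ v j → s j < v → ⊥
  no-value-below (suc v) j (s≤s sj≤v) = unstable (j , constant-from-j)
    where
    constant-from-j : ∀ j′ → j ≤ j′ → s (suc j′) ≡ s j′
    constant-from-j j′ j≤j′ with s (suc j′) ≟ s j′
    ... | yes same = same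
    ... | no drop  = ⊥-elim (no-value-below v (suc j′)
      (<-≤-trans (≤∧≢⇒< (s↓ j′) drop) (≤-trans (antitone s s↓ (≤⇒≤′ j≤j′)) sj≤v)))

¬¬-stabilises-family : ∀ m (f : ℕ → Subset m → ℕ) → (∀ j P → f (suc j) P ≤ f j P) →
                       ¬ ¬ (∃[ N ] (∀ j → N ≤ j → ∀ P → f (suc j) P ≡ f j P))
¬¬-stabilises-family zero f f↓ = do
  (N , stable) ← ¬¬-stabilises (λ j → f j []) (λ j → f↓ j [])
  pure (N , λ { j N≤j [] → stable j N≤j })
¬¬-stabilises-family (suc m) f f↓ = do
  (N₁ , stable₁) ← ¬¬-stabilises-family m (λ j P → f j (inside ∷ P)) (λ j P → f↓ j (inside ∷ P))
  (N₂ , stable₂) ← ¬¬-stabilises-family m (λ j P → f j (outside ∷ P)) (λ j P → f↓ j (outside ∷ P))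
  pure (N₁ ⊔ N₂ , λ
    { j N≤j (true ∷ P)  → stable₁ j (≤-trans (m≤m⊔n N₁ N₂) N≤j) P
    ; j N≤j (false ∷ P) → stable₂ j (≤-trans (m≤n⊔m N₁ N₂) N≤j) P })

module _ {n k : ℕ} (A : BA n k) where

  ∈-post⁺ : ∀ {R a q r} → r ∈ R → q ∈ δ A r a → q ∈ post A R a
  ∈-post⁺ {R} {a} {q} {r} r∈R q∈δra = lookup⇒[]= q _ (trans (lookup∘tabulate _ q)
    (dec-true (any? λ r → (r ∈? R) ×-dec (q ∈? δ A r a)) (r , r∈R , q∈δra)))

  ∈-post⁻ : ∀ {R a q} → q ∈ post A R a → ∃[ r ] (r ∈ R × q ∈ δ A r a)
  ∈-post⁻ {R} {a} {q} q∈post = toWitness (Equivalence.from T-≡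
    (trans (isYes≗does q∈post?) (trans (sym (lookup∘tabulate _ q)) ([]=⇒lookup q∈post))))
    where
    q∈post? : Dec (∃[ r ] (r ∈ R × q ∈ δ A r a))
    q∈post? = any? λ r → (r ∈? R) ×-dec (q ∈? δ A r a)

  ∈-predecessors : ∀ {R a S} → post A R a ≡ S → R List.∈ predecessors A S
  ∈-predecessors {R} {a} {S} postRa≡S =
    ∈-filter⁺ (λ R → any? λ a → post A R a ≟S S) (∈-allSubsets n R) (a , postRa≡S)

  infAt : Fin n → ℕ → ℕ
  infAt q x = if does (q ∈? QF A) then x ∸ 1 else x

  infAt-mono : ∀ q {x y} → x ≤ y → infAt q x ≤ infAt q y
  infAt-mono q x≤y with does (q ∈? QF A)
  ... | true  = ∸-monoˡ-≤ 1 x≤y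
  ... | false = x≤y

  ≤-infAt-⊓ : ∀ q {r x y} → r ≤ infAt q x → r ≤ infAt q y → r ≤ infAt q (x ⊓ y)
  ≤-infAt-⊓ q {r} {x} {y} r≤x r≤y with does (q ∈? QF A)
  ... | true  = subst (r ≤_) (sym (∸-distribʳ-⊓ 1 x y)) (⊓-glb r≤x r≤y)
  ... | false = ⊓-glb r≤x r≤y

  infAt-nonaccepting : ∀ {q} x → ¬ q ∈ QF A → infAt q x ≡ x
  infAt-nonaccepting {q} x q∉F with q ∈? QF A
  ... | yes q∈F = ⊥-elim (q∉F q∈F)
  ... | no _    = refl

  updOut≤OuterStep : ∀ {μ S₀ μ′} → OuterStep A μ S₀ μ′ → ∀ P → updOut A μ P ≤ μ′ P
  updOut≤OuterStep {μ} {S₀} (at-S₀ , elsewhere) P with P ≟S S₀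
  ... | yes refl = ≤-reflexive (sym at-S₀)
  ... | no P≢S₀  = subst (updOut A μ P ≤_) (sym (elsewhere P P≢S₀)) (m⊓n≤m _ _)

  OuterStep≤ : ∀ {μ S₀ μ′} → OuterStep A μ S₀ μ′ → ∀ P → μ′ P ≤ μ P
  OuterStep≤ {S₀ = S₀} (at-S₀ , elsewhere) P with P ≟S S₀
  ... | yes refl = ≤-trans (≤-reflexive at-S₀) (m⊓n≤m _ _)
  ... | no P≢S₀  = ≤-reflexive (elsewhere P P≢S₀)

  module _ (α : Word k) where
    open RunDAG A α

    level : ℕ → Subset n
    level zero    = I A
    level (suc i) = post A (level i) (α i)

    ∈level⇒InDAG : ∀ {i q} → q ∈ level i → InDAG i q
    ∈level⇒InDAG {zero}  q∈I      = init q∈I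
    ∈level⇒InDAG {suc i} q∈post with ∈-post⁻ q∈post
    ... | r , r∈level , q∈δ = next (∈level⇒InDAG r∈level) q∈δ

    InDAG⇒∈level : ∀ {i q} → InDAG i q → q ∈ level i
    InDAG⇒∈level (init q∈I)       = q∈I
    InDAG⇒∈level (next inDAG q∈δ) = ∈-post⁺ (InDAG⇒∈level inDAG) q∈δ

    level-unique : ∀ {m S} → (∀ q → (q ∈ S) ⇔ InLevel m q) → S ≡ level m
    level-unique S⇔level = ⊆-antisym
      (λ q∈S → InDAG⇒∈level (Equivalence.to (S⇔level _) q∈S))
      (λ q∈level → Equivalence.from (S⇔level _) (∈level⇒InDAG q∈level))

    Gev-antitone : ∀ {j j′ v} → j ≤′ j′ → Gev j′ v → Gev j v
    Gev-antitone ≤′-refl        inGev = inGev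
    Gev-antitone (≤′-step j≤j′) inGev = Gev-antitone j≤j′ (proj₁ (proj₁ inGev))

    stage : ∀ {v r} → HasRank v r → ℕ
    stage (finite {j} _ _ _)     = j
    stage (endangered {j} _ _ _) = j

    Gev-stage : ∀ {v r} (h : HasRank v r) → Gev (stage h) v
    Gev-stage (finite _ inGev _)      = inGev
    Gev-stage (endangered _ inGodd _) = proj₁ inGodd

    ¬Gev-after-stage : ∀ {v r} (h : HasRank v r) → ¬ Gev (suc (stage h)) v
    ¬Gev-after-stage (finite _ _ fin)        inGev = proj₂ (proj₁ inGev) fin
    ¬Gev-after-stage (endangered _ _ danger) inGev = proj₂ inGev danger

    HasRank-functional : ∀ {v a b} → HasRank v a → HasRank v b → a ≡ b
    HasRank-functional h h′ with <-cmp (stage h) (stage h′)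
    ... | tri< j<j′ _ _ = ⊥-elim (¬Gev-after-stage h (Gev-antitone (≤⇒≤′ j<j′) (Gev-stage h′)))
    ... | tri> _ _ j′<j = ⊥-elim (¬Gev-after-stage h′ (Gev-antitone (≤⇒≤′ j′<j) (Gev-stage h)))
    ... | tri≈ _ j≡j′ _ = same-stage h h′ j≡j′
      where
      same-stage : ∀ {v a b} (h : HasRank v a) (h′ : HasRank v b) → stage h ≡ stage h′ → a ≡ b
      same-stage (finite _ _ _)          (finite _ _ _)          refl = refl
      same-stage (finite _ _ fin)        (endangered _ inGodd _) refl = ⊥-elim (proj₂ inGodd fin)
      same-stage (endangered _ inGodd _) (finite _ _ fin)        refl = ⊥-elim (proj₂ inGodd fin)
      same-stage (endangered _ _ _)      (endangered _ _ _)      refl = refl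

    F-functional : ∀ {m q a b} → F m q a → F m q b → a ≡ b
    F-functional (inj₁ (_ , refl))    (inj₁ (_ , refl))    = refl
    F-functional (inj₁ (q∉level , _)) (inj₂ (q∈level , _)) = ⊥-elim (q∉level q∈level)
    F-functional (inj₂ (q∈level , _)) (inj₁ (q∉level , _)) = ⊥-elim (q∉level q∈level)
    F-functional (inj₂ (_ , h))       (inj₂ (_ , h′))      = HasRank-functional h h′

    F-odd⇒nonaccepting : ∀ {m q r} → Odd r → F m q r → ¬ q ∈ QF A
    F-odd⇒nonaccepting (_ , 0≡odd)  (inj₁ (_ , refl))             = ⊥-elim (0≢1+n 0≡odd)
    F-odd⇒nonaccepting (b , 2a≡odd) (inj₂ (_ , finite {j} _ _ _)) = ⊥-elim (even≢odd j b 2a≡odd)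
    F-odd⇒nonaccepting _ (inj₂ (_ , endangered _ inGodd danger)) = proj₁ (danger _ (here inGodd))

    F≤tight-rank : ∀ {m q r r′} → TightWithRank m r → F m q r′ → r′ ≤ r
    F≤tight-rank {q = q} (_ , ranks≤r , _) q↦r′ with ranks≤r q
    ... | s , q↦s , s≤r = subst (_≤ _) (F-functional q↦s q↦r′) s≤r

    F≤infAt-rank : ∀ {m q r r′} → TightWithRank m r → F m q r′ → r′ ≤ infAt q r
    F≤infAt-rank {q = q} tight@((_ , refl) , _) q↦r′ with q ∈? QF A
    ... | no _    = F≤tight-rank tight q↦r′
    ... | yes q∈F = ≤-pred (≤∧≢⇒< (F≤tight-rank tight q↦r′)
                      λ { refl → F-odd⇒nonaccepting (proj₁ tight) q↦r′ q∈F })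

    Bounds : (Subset n → Fin n → ℕ) → ℕ → Set
    Bounds ν m = ∀ S → (∀ q → (q ∈ S) ⇔ InLevel m q) → ∀ q r → F m q r → r ≤ ν S q

    Bounds-mono : ∀ {μ μ′ m} → (∀ S → μ S ≤ μ′ S) → Bounds (infFun A μ) m → Bounds (infFun A μ′) m
    Bounds-mono μ≤μ′ bounds S S⇔level q r q↦r =
      ≤-trans (bounds S S⇔level q r q↦r) (infAt-mono q (μ≤μ′ S))

    tight-rank≤μ-level : ∀ {μ m r} → TightWithRank m r → Bounds (infFun A μ) m → r ≤ μ (level m)
    tight-rank≤μ-level {μ} {m} {r} (r-odd , _ , (q , q↦r) , _) bounds =
      subst (r ≤_) (infAt-nonaccepting _ (F-odd⇒nonaccepting r-odd q↦r))
        (bounds (level m) (λ _ → mk⇔ ∈level⇒InDAG InDAG⇒∈level) q r q↦r)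

    Bounds-updOut : ∀ {μ m r} → TightWithRank m r → TightWithRank (suc m) r →
                    Bounds (infFun A μ) m → Bounds (infFun A μ) (suc m) →
                    Bounds (infFun A (updOut A μ)) (suc m)
    Bounds-updOut {μ} {r = r} tight tight′ bounds bounds′ S S⇔level q r′ q↦r′ =
      ≤-infAt-⊓ q (bounds′ S S⇔level q r′ q↦r′)
        (≤-trans (F≤infAt-rank tight′ q↦r′) (infAt-mono q r≤max))
      where
      r≤max : r ≤ maxList (map μ (predecessors A S))
      r≤max = ≤-trans (tight-rank≤μ-level tight bounds)
        (∈⇒≤maxList (∈-map⁺ μ (∈-predecessors (sym (level-unique S⇔level)))))

  TRUB-step : ∀ {μ S₀ μ′} → OuterStep A μ S₀ μ′ → TRUB A μ → TRUB A μ′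
  TRUB-step {μ′ = μ′} step trub α α∉L with trub α α∉L
  ... | ℓ , (r , tight) , bounded =
    suc ℓ , (r , λ m ℓ<m → tight m (<⇒≤ ℓ<m)) , bounded′
    where
    bounded′ : ∀ m → suc ℓ ≤ m → Bounds α (infFun A μ′) m
    bounded′ (suc m) (s≤s ℓ≤m) = Bounds-mono α (updOut≤OuterStep step)
      (Bounds-updOut α (tight m ℓ≤m) (tight (suc m) (m≤n⇒m≤1+n ℓ≤m))
        (bounded m ℓ≤m) (bounded (suc m) (m≤n⇒m≤1+n ℓ≤m)))

corollary1 : ∀ {n k} (A : BA n k) (μ : ℕ → Subset n → ℕ) (S : ℕ → Subset n) →
    TRUB A (μ 0) →
    (∀ j → OuterStep A (μ j) (S j) (μ (suc j))) →
    (∀ j → TRUB A (μ j))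
    × ¬ ¬ (∃[ N ] (∀ j → N ≤ j → ∀ P → μ (suc j) P ≡ μ j P))
corollary1 {n} A μ S trub₀ steps = trubs , ¬¬-stabilises-family n μ (λ j → OuterStep≤ A (steps j))
  where
  trubs : ∀ j → TRUB A (μ j)
  trubs zero    = trub₀
  trubs (suc j) = TRUB-step A (steps j) (trubs j)
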